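{- Let $\mathcal{C}$ be a $d$-uniform clutter on vertex set $V$ such that every induced subclutter of $\mathcal{C}$ with at least one vertex has a complete-neighborhood vertex. Then the Alexander dual (over $V$) of $I(c_d(\mathcal{C}))$ is vertex decomposable.
   Context: A clutter on finite vertex set $V$ is a set of subsets (circuits) of $V$, none properly containing another; $d$-uniform means all circuits have $d$ elements. The induced subclutter on $W\subseteq V$ has vertex set $W$ and circuits the circuits of $\mathcal{C}$ contained in $W$. In a $d$-uniform clutter, a vertex $v$ is a complete-neighborhood vertex if, with $S=\{x: x,v\in e\text{ for some circuit } e\}$, the induced subclutter on $S$ has as circuits all $d$-subsets of $S$. $c_d(\mathcal{C})$ is the clutter on $V$ whose circuits are the $d$-subsets of $V$ that are not circuits of $\mathcal{C}$. $I(\mathcal{D})$ is the simplicial complex of subsets of $V$ containing no circuit of $\mathcal{D}$; its Alexander dual over $V$ has facets $V\setminus e$ for $e$ a circuit of $\mathcal{D}$. A complex $\Delta$ on vertex set $W$ is vertex decomposable if it is a simplex, or $\{\}$ or $\{\emptyset\}$, or it has a vertex $v$ such that every face $\tau\ni v$ admits $w\in W\setminus\tau$ with $(\tau\cup\{w\})\setminus\{v\}\in\Delta$, and both $\Delta\setminus v$ (faces not containing $v$) and $\operatorname{link}_\Delta v=\{\tau:v\notin\tau,\tau\cup\{v\}\in\Delta\}$ are vertex decomposable. -}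

module Defs where

open import Data.Nat using (ℕ)
open import Data.Bool using (Bool; true; false)
open import Data.Fin using (Fin)
open import Data.Fin.Subset using (Subset; _∈_; _∉_; _⊆_; ∁; _∪_; _-_; ⁅_⁆; ∣_∣; Nonempty)
open import Data.Product using (Σ; _×_; ∃)
open import Data.Empty using (⊥)
open import Relation.Nullary using (¬_)
open import Relation.Binary.PropositionalEquality using (_≡_)
open import Function.Bundles using (_⇔_)

-- Vertex set V = Fin n.  A family of subsets of V is given by its
-- (decidable) characteristic function; e is a circuit iff  C e ≡ true.
Family : ℕ → Set
Family n = Subset n → Bool

IsClutter : ∀ {n} → Family n → Set
IsClutter C = ∀ e f → C e ≡ true → C f ≡ true → e ⊆ f → e ≡ f

Uniform : ∀ {n} → ℕ → Family n → Set
Uniform d C = ∀ e → C e ≡ true → ∣ e ∣ ≡ d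

InducedCircuit : ∀ {n} → Family n → Subset n → Subset n → Set
InducedCircuit C W e = (C e ≡ true) × (e ⊆ W)

Nbhd : ∀ {n} → Family n → Subset n → Fin n → Fin n → Set
Nbhd C W v x = Σ (Subset _) λ e → InducedCircuit C W e × (x ∈ e) × (v ∈ e)

-- v is a complete-neighborhood vertex of the d-uniform induced subclutter on W:
-- v ∈ W and the induced subclutter on S has as circuits exactly the d-subsets of S
-- (circuits of the induced subclutter on S = circuits of C[W] contained in S)
CompleteNbhdVertex : ∀ {n} → ℕ → Family n → Subset n → Fin n → Set
CompleteNbhdVertex d C W v =
  (v ∈ W) ×
  (∀ e → ((InducedCircuit C W e × (∀ {x} → x ∈ e → Nbhd C W v x))
          ⇔ ((∀ {x} → x ∈ e → Nbhd C W v x) × (∣ e ∣ ≡ d))))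

cd : ∀ {n} → ℕ → Family n → Subset n → Set
cd d C e = (∣ e ∣ ≡ d) × (C e ≡ false)

Complex : ℕ → Set₁
Complex n = Subset n → Set

Ind : ∀ {n} → (Subset n → Set) → Complex n
Ind D σ = ∀ e → D e → ¬ (e ⊆ σ)

AlexDual : ∀ {n} → Complex n → Complex n
AlexDual Δ σ = ¬ Δ (∁ σ)

del : ∀ {n} → Complex n → Fin n → Complex n
del Δ v τ = (v ∉ τ) × Δ τ

lk : ∀ {n} → Complex n → Fin n → Complex n
lk Δ v τ = (v ∉ τ) × Δ (τ ∪ ⁅ v ⁆)

Shedding : ∀ {n} → Subset n → Complex n → Fin n → Set
Shedding W Δ v = ∀ τ → Δ τ → v ∈ τ →
  Σ (Fin _) λ w → (w ∈ W) × (w ∉ τ) × Δ ((τ ∪ ⁅ w ⁆) - v)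

data VertexDecomposable {n : ℕ} : Subset n → Complex n → Set₁ where
  simplex : ∀ {W Δ} (F : Subset n) → F ⊆ W → (∀ σ → Δ σ ⇔ σ ⊆ F) →
            VertexDecomposable W Δ
  void    : ∀ {W Δ} → (∀ σ → ¬ Δ σ) → VertexDecomposable W Δ
  emptyC  : ∀ {W Δ} → (∀ σ → Δ σ ⇔ (∀ x → x ∉ σ)) → VertexDecomposable W Δ
  shed    : ∀ {W Δ} (v : Fin n) → v ∈ W → Shedding W Δ v →
            VertexDecomposable (W - v) (del Δ v) →
            VertexDecomposable (W - v) (lk Δ v) →
            VertexDecomposable W Δ

module Submission where

-- For a family D of vertex sets and W ⊆ V, let  Dual D W  be the complex of
-- all σ ⊆ W whose complement W ∖ σ contains a member of D.  For W = V and a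
-- decidable D this is precisely the Alexander dual of I(D).
--
-- Two general facts about these relative duals drive the proof:
--   * the link of a vertex v ∈ W in Dual D W is Dual D (W - v);
--   * v is a shedding vertex of Dual D W as soon as every D-set e ⊆ W
--     avoiding v can trade one of its points for v and stay in D.
-- So Dual D W is vertex decomposable if some v has this exchange property,
-- the deletion of v is (up to the same faces) a dual already known to be
-- vertex decomposable, and Dual D (W - v) is (induction on W).
--
-- This is applied to three families, each using the previous one for its
-- deletions: the sets of size ≥ j; the sets of size ≥ k meeting the
-- complement of a decidable predicate P; and c_d(C) for d ≥ 2, where v is a
-- complete-neighbourhood vertex of C[W] and P is the neighbourhood of v.
-- Degrees d ≤ 1 reduce directly to the first two families.

open import Defs
open import Level using (Level)
open import Data.Nat using (ℕ; zero; suc; pred; _≤_; _<_; z≤n; s≤s)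
  renaming (_≟_ to _≟ℕ_)
open import Data.Nat.Properties
  using (≤-trans; ≤-reflexive; ≤-pred; ≤⇒pred≤; pred-mono-≤; m≤n+m∸n; suc-injective; 1+n≢0)
open import Data.Bool using (true; false)
open import Data.Bool.Properties using (¬-not; not-¬) renaming (_≟_ to _≟ᵇ_)
open import Data.Fin using (Fin)
open import Data.Fin.Properties using (any?) renaming (_≟_ to _≟ᶠ_)
open import Data.Fin.Subset
  using (Subset; inside; outside; _∈_; _∉_; _⊆_; ∁; _∪_; _─_; _-_; ⁅_⁆; ∣_∣; ⊤; ⊥; Nonempty)
open import Data.Fin.Subset.Properties
  using ( drop-there; out⊆; in⊆in; ⊆-trans; ⊆-antisym; ⊆⊤; ⊥⊆; ∈⊤; ∉⊥; Empty-unique; nonempty?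
        ; _∈?_; _⊆?_; anySubset?; ∣⊥∣≡0; ∣⁅x⁆∣≡1; x∈⁅x⁆; x∈⁅y⁆⇒x≡y; x∉⁅y⁆⇒x≢y
        ; x∈p∪q⁺; x∈p∪q⁻; p⊆p∪q; ∪-identityʳ; p─⊥≡p; p─q─r≡p─q∪r; p─q─r≡p─r─q; p─q⊆p
        ; x∈p∧x∉q⇒x∈p─q; x∈p∧x≢y⇒x∈p-y; x∈∁p⇒x∉p; x∉p⇒x∈∁p; x∈p⇒p-x⊂p )
open import Data.Fin.Subset.Induction using (⊂-wellFounded)
open import Data.Vec using (_∷_; here; there)
open import Data.Product using (Σ; _×_; _,_; proj₁; proj₂)
import Data.Product as Product
open import Data.Product.Function.NonDependent.Propositional using (_×-⇔_)
open import Data.Empty using (⊥-elim)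
open import Data.Sum using (_⊎_; inj₁; inj₂)
open import Function using (_∘_)
open import Function.Bundles using (_⇔_; mk⇔; Equivalence)
open import Function.Properties.Equivalence
  using () renaming (refl to ⇔-refl; sym to ⇔-sym; trans to ⇔-trans)
open import Induction.WellFounded using (module All)
open import Relation.Nullary using (¬_; yes; no; contradiction; _×-dec_; ¬?)
open import Relation.Nullary.Decidable using (decidable-stable)
open import Relation.Unary using (Decidable)
open import Relation.Binary.PropositionalEquality
  using (_≡_; _≢_; refl; sym; trans; cong; subst; module ≡-Reasoning)

open Equivalence using (to; from)
open ≡-Reasoning

private
  variable
    ℓ : Level
    n j k : ℕ
    v w x y : Fin n
    e p S U W σ τ : Subset n
    P : Fin n → Set
    D D' : Subset n → Set
    Δ Δ' : Complex n

x∈p─q⁻ : ∀ (p q : Subset n) → x ∈ p ─ q → x ∈ p × x ∉ q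
x∈p─q⁻ (inside ∷ p)  (outside ∷ q) here = here , λ ()
x∈p─q⁻ {x = Fin.zero} (outside ∷ p) (inside ∷ q)  ()
x∈p─q⁻ {x = Fin.zero} (outside ∷ p) (outside ∷ q) ()
x∈p─q⁻ (_ ∷ p) (_ ∷ q) (there x∈p─q) =
  Product.map there (λ x∉q → x∉q ∘ drop-there) (x∈p─q⁻ p q x∈p─q)

x∈p-y⁻ : ∀ (p : Subset n) → x ∈ p - y → x ∈ p × x ≢ y
x∈p-y⁻ {y = y} p x∈p-y = Product.map₂ x∉⁅y⁆⇒x≢y (x∈p─q⁻ p ⁅ y ⁆ x∈p-y)

∪⁅⁆-⊆ : σ ⊆ W → v ∈ W → σ ∪ ⁅ v ⁆ ⊆ W
∪⁅⁆-⊆ {σ = σ} {v = v} σ⊆W v∈W y∈σ∪v with x∈p∪q⁻ σ ⁅ v ⁆ y∈σ∪v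
... | inj₁ y∈σ   = σ⊆W y∈σ
... | inj₂ y∈⁅v⁆ = subst (_∈ _) (sym (x∈⁅y⁆⇒x≡y v y∈⁅v⁆)) v∈W

∪⁅⁆-mono : e ⊆ U → e ∪ ⁅ v ⁆ ⊆ U ∪ ⁅ v ⁆
∪⁅⁆-mono {v = v} e⊆U = ∪⁅⁆-⊆ (⊆-trans e⊆U (p⊆p∪q ⁅ v ⁆)) (x∈p∪q⁺ (inj₂ (x∈⁅x⁆ v)))

-⁅⁆-⊆ : e ⊆ U ∪ ⁅ v ⁆ → e - v ⊆ U
-⁅⁆-⊆ {e = e} {U = U} {v = v} e⊆U∪v y∈e-v with x∈p-y⁻ e y∈e-v
... | y∈e , y≢v with x∈p∪q⁻ U ⁅ v ⁆ (e⊆U∪v y∈e)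
...   | inj₁ y∈U   = y∈U
...   | inj₂ y∈⁅v⁆ = contradiction (x∈⁅y⁆⇒x≡y v y∈⁅v⁆) y≢v

⊆-remove⇔ : σ ⊆ W - v ⇔ (v ∉ σ × σ ⊆ W)
⊆-remove⇔ {σ = σ} {W = W} {v = v} = mk⇔ split join
  where
  split : σ ⊆ W - v → v ∉ σ × σ ⊆ W
  split σ⊆W-v = (λ v∈σ → proj₂ (x∈p-y⁻ W (σ⊆W-v v∈σ)) refl) , ⊆-trans σ⊆W-v (p─q⊆p W _)
  join : v ∉ σ × σ ⊆ W → σ ⊆ W - v
  join (v∉σ , σ⊆W) y∈σ = x∈p∧x≢y⇒x∈p-y (σ⊆W y∈σ) λ { refl → v∉σ y∈σ }

p-x≡p : x ∉ p → p - x ≡ p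
p-x≡p {p = p} x∉p = ⊆-antisym (p─q⊆p p _) λ y∈p → x∈p∧x≢y⇒x∈p-y y∈p λ { refl → x∉p y∈p }

p-x∪⁅x⁆≡p : x ∈ p → (p - x) ∪ ⁅ x ⁆ ≡ p
p-x∪⁅x⁆≡p {x = x} {p = p} x∈p = ⊆-antisym (∪⁅⁆-⊆ (p─q⊆p p _) x∈p) back
  where
  back : p ⊆ (p - x) ∪ ⁅ x ⁆
  back {y} y∈p with y ≟ᶠ x
  ... | yes refl = x∈p∪q⁺ (inj₂ (x∈⁅x⁆ x))
  ... | no y≢x   = x∈p∪q⁺ (inj₁ (x∈p∧x≢y⇒x∈p-y y∈p y≢x))

W─σ∪⁅v⁆≡W-v─σ : ∀ (W σ : Subset n) v → W ─ (σ ∪ ⁅ v ⁆) ≡ (W - v) ─ σ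
W─σ∪⁅v⁆≡W-v─σ W σ v = begin
  W ─ (σ ∪ ⁅ v ⁆)  ≡⟨ sym (p─q─r≡p─q∪r W σ ⁅ v ⁆) ⟩
  (W ─ σ) - v      ≡⟨ p─q─r≡p─r─q W σ ⁅ v ⁆ ⟩
  (W - v) ─ σ      ∎

W-v─σ∪⁅v⁆≡W─σ : v ∈ W → v ∉ σ → ((W - v) ─ σ) ∪ ⁅ v ⁆ ≡ W ─ σ
W-v─σ∪⁅v⁆≡W─σ {v = v} {W = W} {σ = σ} v∈W v∉σ = begin
  ((W - v) ─ σ) ∪ ⁅ v ⁆  ≡⟨ cong (_∪ ⁅ v ⁆) (sym (p─q─r≡p─r─q W σ ⁅ v ⁆)) ⟩
  ((W ─ σ) - v) ∪ ⁅ v ⁆  ≡⟨ p-x∪⁅x⁆≡p (x∈p∧x∉q⇒x∈p─q v∈W v∉σ) ⟩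
  W ─ σ                  ∎

∣p∣≡1+∣p-x∣ : ∀ (p : Subset n) → x ∈ p → ∣ p ∣ ≡ suc ∣ p - x ∣
∣p∣≡1+∣p-x∣ (inside ∷ p)  here          = cong suc (cong ∣_∣ (sym (p─⊥≡p p)))
∣p∣≡1+∣p-x∣ (inside ∷ p)  (there x∈p)   = cong suc (∣p∣≡1+∣p-x∣ p x∈p)
∣p∣≡1+∣p-x∣ (outside ∷ p) (there x∈p)   = ∣p∣≡1+∣p-x∣ p x∈p

∣p∪⁅x⁆∣≡1+∣p∣ : ∀ (p : Subset n) → x ∉ p → ∣ p ∪ ⁅ x ⁆ ∣ ≡ suc ∣ p ∣
∣p∪⁅x⁆∣≡1+∣p∣ {x = Fin.zero}  (outside ∷ p) _   = cong suc (cong ∣_∣ (∪-identityʳ p))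
∣p∪⁅x⁆∣≡1+∣p∣ {x = Fin.zero}  (inside ∷ p)  x∉p = contradiction here x∉p
∣p∪⁅x⁆∣≡1+∣p∣ {x = Fin.suc x} (outside ∷ p) x∉p = ∣p∪⁅x⁆∣≡1+∣p∣ p (x∉p ∘ there)
∣p∪⁅x⁆∣≡1+∣p∣ {x = Fin.suc x} (inside ∷ p)  x∉p = cong suc (∣p∪⁅x⁆∣≡1+∣p∣ p (x∉p ∘ there))

pred≤∣p-x∣ : ∀ (p : Subset n) x → k ≤ ∣ p ∣ → pred k ≤ ∣ p - x ∣
pred≤∣p-x∣ {k = k} p x k≤∣p∣ with x ∈? p
... | yes x∈p = pred-mono-≤ (≤-trans k≤∣p∣ (≤-reflexive (∣p∣≡1+∣p-x∣ p x∈p)))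
... | no x∉p  = subst (λ q → pred k ≤ ∣ q ∣) (sym (p-x≡p x∉p)) (≤⇒pred≤ k≤∣p∣)

insert-size : k ≤ ∣ e ∣ → v ∉ e → suc k ≤ ∣ e ∪ ⁅ v ⁆ ∣
insert-size {e = e} k≤∣e∣ v∉e = ≤-trans (s≤s k≤∣e∣) (≤-reflexive (sym (∣p∪⁅x⁆∣≡1+∣p∣ e v∉e)))

∣swap∣ : w ∈ e → v ∉ e → ∣ (e - w) ∪ ⁅ v ⁆ ∣ ≡ ∣ e ∣
∣swap∣ {w = w} {e = e} {v = v} w∈e v∉e = begin
  ∣ (e - w) ∪ ⁅ v ⁆ ∣  ≡⟨ ∣p∪⁅x⁆∣≡1+∣p∣ (e - w) (v∉e ∘ proj₁ ∘ x∈p-y⁻ e) ⟩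
  suc ∣ e - w ∣        ≡⟨ sym (∣p∣≡1+∣p-x∣ e w∈e) ⟩
  ∣ e ∣                ∎

∣p∣≡0⇒p≡⊥ : ∣ p ∣ ≡ 0 → p ≡ ⊥
∣p∣≡0⇒p≡⊥ {p = p} ∣p∣≡0 =
  Empty-unique λ (x , x∈p) → 1+n≢0 (trans (sym (∣p∣≡1+∣p-x∣ p x∈p)) ∣p∣≡0)

nonempty-of-size : ∀ {n} {p : Subset n} → 0 < ∣ p ∣ → Nonempty p
nonempty-of-size {n = n} {p = p} 0<∣p∣ with nonempty? p
... | yes nonempty = nonempty
... | no empty     = contradiction (subst (0 <_) ∣p∣≡0 0<∣p∣) λ ()
  where
  ∣p∣≡0 : ∣ p ∣ ≡ 0
  ∣p∣≡0 = trans (cong ∣_∣ (Empty-unique empty)) (∣⊥∣≡0 n)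

positive⊈empty : ¬ Nonempty W → 0 < ∣ e ∣ → ¬ e ⊆ W
positive⊈empty empty 0<∣e∣ e⊆W = empty (Product.map₂ e⊆W (nonempty-of-size 0<∣e∣))

∣p∣≡1⇒p≡⁅x⁆ : x ∈ p → ∣ p ∣ ≡ 1 → p ≡ ⁅ x ⁆
∣p∣≡1⇒p≡⁅x⁆ {x = x} {p = p} x∈p ∣p∣≡1 =
  ⊆-antisym only-x λ y∈⁅x⁆ → subst (_∈ p) (sym (x∈⁅y⁆⇒x≡y x y∈⁅x⁆)) x∈p
  where
  p-x≡⊥ : p - x ≡ ⊥
  p-x≡⊥ = ∣p∣≡0⇒p≡⊥ (suc-injective (trans (sym (∣p∣≡1+∣p-x∣ p x∈p)) ∣p∣≡1))
  only-x : p ⊆ ⁅ x ⁆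
  only-x {y} y∈p with y ≟ᶠ x
  ... | yes refl = x∈⁅x⁆ x
  ... | no y≢x   = contradiction (subst (y ∈_) p-x≡⊥ (x∈p∧x≢y⇒x∈p-y y∈p y≢x)) ∉⊥

pick : ∀ (S : Subset n) → k ≤ ∣ S ∣ → Σ (Subset n) λ T → T ⊆ S × ∣ T ∣ ≡ k
pick {n} {zero} S              _           = ⊥ , ⊥⊆ , ∣⊥∣≡0 n
pick {k = suc k} (inside ∷ S)   (s≤s k≤∣S∣) =
  let T , T⊆S , ∣T∣≡k = pick S k≤∣S∣ in inside ∷ T , in⊆in T⊆S , cong suc ∣T∣≡k
pick {k = suc k} (outside ∷ S)  k<∣S∣       =
  let T , T⊆S , ∣T∣≡k = pick S k<∣S∣ in outside ∷ T , out⊆ T⊆S , ∣T∣≡k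

pick-through : x ∈ S → suc k ≤ ∣ S ∣ → Σ (Subset n) λ T → T ⊆ S × x ∈ T × ∣ T ∣ ≡ suc k
pick-through {x = x} {S = S} x∈S k<∣S∣
  with pick (S - x) (≤-pred (≤-trans k<∣S∣ (≤-reflexive (∣p∣≡1+∣p-x∣ S x∈S))))
... | T , T⊆S-x , ∣T∣≡k =
  T ∪ ⁅ x ⁆ , ∪⁅⁆-⊆ (⊆-trans T⊆S-x (p─q⊆p S _)) x∈S , x∈p∪q⁺ (inj₂ (x∈⁅x⁆ x)) ,
  trans (∣p∪⁅x⁆∣≡1+∣p∣ T (λ x∈T → proj₂ (x∈p-y⁻ S (T⊆S-x x∈T)) refl)) (cong suc ∣T∣≡k)

outside-or-inside : Decidable P → (S : Subset n) →
  (Σ (Fin n) λ x → x ∈ S × ¬ P x) ⊎ (∀ {x} → x ∈ S → P x)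
outside-or-inside P? S with any? (λ x → x ∈? S ×-dec ¬? (P? x))
... | yes witness = inj₁ witness
... | no none     = inj₂ λ {x} x∈S → decidable-stable (P? x) λ ¬Px → none (x , x∈S , ¬Px)

removal-induction : (Q : Subset n → Set ℓ) →
  (∀ W → (∀ {v} → v ∈ W → Q (W - v)) → Q W) → ∀ W → Q W
removal-induction {ℓ = ℓ} Q step =
  All.wfRec ⊂-wellFounded ℓ Q λ W ih → step W λ v∈W → ih (x∈p⇒p-x⊂p v∈W)

vd-resp : (∀ σ → Δ σ ⇔ Δ' σ) → VertexDecomposable W Δ → VertexDecomposable W Δ'
vd-resp Δ⇔Δ' (simplex F F⊆W Δ⇔⊆F) = simplex F F⊆W λ σ → ⇔-trans (⇔-sym (Δ⇔Δ' σ)) (Δ⇔⊆F σ)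
vd-resp Δ⇔Δ' (void noFace)         = void λ σ → noFace σ ∘ from (Δ⇔Δ' σ)
vd-resp Δ⇔Δ' (emptyC Δ⇔∅)          = emptyC λ σ → ⇔-trans (⇔-sym (Δ⇔Δ' σ)) (Δ⇔∅ σ)
vd-resp Δ⇔Δ' (shed v v∈W shedding vd-del vd-lk) =
  shed v v∈W shedding'
    (vd-resp (λ σ → ⇔-refl ×-⇔ Δ⇔Δ' σ) vd-del)
    (vd-resp (λ σ → ⇔-refl ×-⇔ Δ⇔Δ' (σ ∪ ⁅ v ⁆)) vd-lk)
  where
  shedding' : Shedding _ _ v
  shedding' τ τ∈Δ' v∈τ =
    let w , w∈W , w∉τ , τ'∈Δ = shedding τ (from (Δ⇔Δ' τ) τ∈Δ') v∈τ
    in  w , w∈W , w∉τ , to (Δ⇔Δ' _) τ'∈Δ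

Hits : (Subset n → Set) → Subset n → Set
Hits D U = Σ (Subset _) λ e → D e × e ⊆ U

Dual : (Subset n → Set) → Subset n → Complex n
Dual D W σ = σ ⊆ W × Hits D (W ─ σ)

alexDual⇔Dual : Decidable D → ∀ σ → AlexDual (Ind D) σ ⇔ Dual D ⊤ σ
alexDual⇔Dual {D = D} D? σ = mk⇔ hit
  λ (_ , e , De , e⊆⊤─σ) notInd →
    notInd e De λ x∈e → x∉p⇒x∈∁p (proj₂ (x∈p─q⁻ ⊤ σ (e⊆⊤─σ x∈e)))
  where
  hit : AlexDual (Ind D) σ → Dual D ⊤ σ
  hit notInd with anySubset? {P = λ e → D e × e ⊆ ∁ σ} (λ e → D? e ×-dec e ⊆? ∁ σ)
  ... | yes (e , De , e⊆∁σ) = ⊆⊤ , e , De , λ x∈e → x∈p∧x∉q⇒x∈p─q ∈⊤ (x∈∁p⇒x∉p (e⊆∁σ x∈e))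
  ... | no none             = contradiction (λ e De e⊆∁σ → none (e , De , λ {x} → e⊆∁σ {x})) notInd

Dual-cong : (∀ U → Hits D U ⇔ Hits D' U) → ∀ σ → Dual D W σ ⇔ Dual D' W σ
Dual-cong sameHits σ = ⇔-refl ×-⇔ sameHits _

void-Dual : (∀ e → D e → ¬ e ⊆ W) → VertexDecomposable W (Dual D W)
void-Dual noneFits = void λ σ (_ , e , De , e⊆W─σ) → noneFits e De (⊆-trans e⊆W─σ (p─q⊆p _ σ))

link-Dual : v ∈ W → ∀ σ → Dual D (W - v) σ ⇔ lk (Dual D W) v σ
link-Dual {v = v} {W = W} v∈W σ = mk⇔
  (λ (σ⊆W-v , hits) → let v∉σ , σ⊆W = to ⊆-remove⇔ σ⊆W-v in
     v∉σ , ∪⁅⁆-⊆ σ⊆W v∈W , subst (Hits _) (sym (W─σ∪⁅v⁆≡W-v─σ W σ v)) hits)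
  (λ (v∉σ , σ∪v⊆W , hits) →
     from ⊆-remove⇔ (v∉σ , ⊆-trans (p⊆p∪q ⁅ v ⁆) σ∪v⊆W) ,
     subst (Hits _) (W─σ∪⁅v⁆≡W-v─σ W σ v) hits)

DeletionMatch : (D D' : Subset n → Set) → Subset n → Fin n → Set
DeletionMatch D D' W v = ∀ U → U ⊆ W - v → Hits D (U ∪ ⁅ v ⁆) ⇔ Hits D' U

deletion-Dual : v ∈ W → DeletionMatch D D' W v →
  ∀ σ → Dual D' (W - v) σ ⇔ del (Dual D W) v σ
deletion-Dual {v = v} {W = W} v∈W match σ = mk⇔
  (λ (σ⊆W-v , hits') → let v∉σ , σ⊆W = to ⊆-remove⇔ σ⊆W-v in
     v∉σ , σ⊆W ,
     subst (Hits _) (W-v─σ∪⁅v⁆≡W─σ v∈W v∉σ) (from (match _ (p─q⊆p (W - v) σ)) hits'))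
  (λ (v∉σ , σ⊆W , hits) →
     from ⊆-remove⇔ (v∉σ , σ⊆W) ,
     to (match _ (p─q⊆p (W - v) σ)) (subst (Hits _) (sym (W-v─σ∪⁅v⁆≡W─σ v∈W v∉σ)) hits))

Exchange : (Subset n → Set) → Subset n → Fin n → Set
Exchange D W v = ∀ e → D e → e ⊆ W → v ∉ e → Σ (Fin _) λ w → w ∈ e × D ((e - w) ∪ ⁅ v ⁆)

exchange-⊆ : τ ⊆ W → v ∈ τ → e ⊆ W ─ τ → (e - w) ∪ ⁅ v ⁆ ⊆ W ─ ((τ ∪ ⁅ w ⁆) - v)
exchange-⊆ {τ = τ} {W = W} {v = v} {e = e} {w = w} τ⊆W v∈τ e⊆W─τ {y} y∈e'
  with x∈p∪q⁻ (e - w) ⁅ v ⁆ y∈e'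
... | inj₂ y∈⁅v⁆ rewrite x∈⁅y⁆⇒x≡y v y∈⁅v⁆ =
  x∈p∧x∉q⇒x∈p─q (τ⊆W v∈τ) λ v∈τ' → proj₂ (x∈p-y⁻ (τ ∪ ⁅ w ⁆) v∈τ') refl
... | inj₁ y∈e-w with x∈p-y⁻ e y∈e-w
...   | y∈e , y≢w with x∈p─q⁻ W τ (e⊆W─τ y∈e)
...     | y∈W , y∉τ = x∈p∧x∉q⇒x∈p─q y∈W (y∉τ∪w ∘ proj₁ ∘ x∈p-y⁻ (τ ∪ ⁅ w ⁆))
  where
  y∉τ∪w : y ∉ τ ∪ ⁅ w ⁆
  y∉τ∪w y∈τ∪w with x∈p∪q⁻ τ ⁅ w ⁆ y∈τ∪w
  ... | inj₁ y∈τ   = y∉τ y∈τ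
  ... | inj₂ y∈⁅w⁆ = y≢w (x∈⁅y⁆⇒x≡y w y∈⁅w⁆)

shedding-Dual : Exchange D W v → Shedding W (Dual D W) v
shedding-Dual {W = W} exchange τ (τ⊆W , e , De , e⊆W─τ) v∈τ
  with exchange e De (⊆-trans e⊆W─τ (p─q⊆p W τ)) (λ v∈e → proj₂ (x∈p─q⁻ W τ (e⊆W─τ v∈e)) v∈τ)
... | u , u∈e , De' with x∈p─q⁻ W τ (e⊆W─τ u∈e)
...   | u∈W , u∉τ =
  u , u∈W , u∉τ , ⊆-trans (p─q⊆p _ _) (∪⁅⁆-⊆ τ⊆W u∈W) , _ , De' , exchange-⊆ τ⊆W v∈τ e⊆W─τ

shed-Dual : v ∈ W → Exchange D W v → DeletionMatch D D' W v →
  VertexDecomposable (W - v) (Dual D' (W - v)) →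
  VertexDecomposable (W - v) (Dual D (W - v)) →
  VertexDecomposable W (Dual D W)
shed-Dual {v = v} v∈W exchange match vd-deletion vd-link =
  shed v v∈W (shedding-Dual exchange)
    (vd-resp (deletion-Dual v∈W match) vd-deletion)
    (vd-resp (link-Dual v∈W) vd-link)

AtLeast : ℕ → Subset n → Set
AtLeast j e = j ≤ ∣ e ∣

exchange-AtLeast : Exchange (AtLeast (suc j)) W v
exchange-AtLeast e j<∣e∣ _ v∉e =
  let w , w∈e = nonempty-of-size (≤-trans (s≤s z≤n) j<∣e∣)
  in  w , w∈e , ≤-trans j<∣e∣ (≤-reflexive (sym (∣swap∣ w∈e v∉e)))

-- Removing v costs at most one element, adding it gains one.
deletion-AtLeast : DeletionMatch (AtLeast (suc j)) (AtLeast j) W v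
deletion-AtLeast {j = j} {v = v} U U⊆W-v = mk⇔ remove insert
  where
  remove : Hits (AtLeast (suc j)) (U ∪ ⁅ v ⁆) → Hits (AtLeast j) U
  remove (e , j<∣e∣ , e⊆U∪v) = e - v , pred≤∣p-x∣ e v j<∣e∣ , -⁅⁆-⊆ e⊆U∪v
  insert : Hits (AtLeast j) U → Hits (AtLeast (suc j)) (U ∪ ⁅ v ⁆)
  insert (e , j≤∣e∣ , e⊆U) =
    e ∪ ⁅ v ⁆ , insert-size j≤∣e∣ (proj₁ (to ⊆-remove⇔ U⊆W-v) ∘ e⊆U) , ∪⁅⁆-mono e⊆U

vd-AtLeast : ∀ {n} (W : Subset n) j → VertexDecomposable W (Dual (AtLeast j) W)
vd-AtLeast {n} = removal-induction (λ W → ∀ j → VertexDecomposable W (Dual (AtLeast j) W)) step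
  where
  step : ∀ (W : Subset n) → (∀ {v} → v ∈ W → ∀ j → VertexDecomposable (W - v) (Dual (AtLeast j) (W - v))) →
         ∀ j → VertexDecomposable W (Dual (AtLeast j) W)
  step W ih zero =
    simplex W (λ y∈W → y∈W) λ σ → mk⇔ proj₁ λ σ⊆W → σ⊆W , W ─ σ , z≤n , λ {_} y∈W─σ → y∈W─σ
  step W ih (suc j) with nonempty? W
  ... | no empty      = void-Dual λ e j<∣e∣ → positive⊈empty empty (≤-trans (s≤s z≤n) j<∣e∣)
  ... | yes (v , v∈W) =
    shed-Dual v∈W exchange-AtLeast deletion-AtLeast (ih v∈W j) (ih v∈W (suc j))

Escaping : (Fin n → Set) → ℕ → Subset n → Set
Escaping P k e = (Σ (Fin _) λ x → x ∈ e × ¬ P x) × k ≤ ∣ e ∣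

-- A vertex outside P can always be swapped in for the escaping point.
exchange-Escaping : ¬ P v → Exchange (Escaping P k) W v
exchange-Escaping ¬Pv e ((x , x∈e , _) , k≤∣e∣) _ v∉e =
  x , x∈e , (_ , x∈p∪q⁺ (inj₂ (x∈⁅x⁆ _)) , ¬Pv) , ≤-trans k≤∣e∣ (≤-reflexive (sym (∣swap∣ x∈e v∉e)))

deletion-Escaping : ¬ P v → DeletionMatch (Escaping P k) (AtLeast (pred k)) W v
deletion-Escaping {P = P} {v = v} {k = k} ¬Pv U U⊆W-v = mk⇔ remove insert
  where
  remove : Hits (Escaping P k) (U ∪ ⁅ v ⁆) → Hits (AtLeast (pred k)) U
  remove (e , (_ , k≤∣e∣) , e⊆U∪v) = e - v , pred≤∣p-x∣ e v k≤∣e∣ , -⁅⁆-⊆ e⊆U∪v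
  insert : Hits (AtLeast (pred k)) U → Hits (Escaping P k) (U ∪ ⁅ v ⁆)
  insert (e , k-1≤∣e∣ , e⊆U) =
    e ∪ ⁅ v ⁆ ,
    ((v , x∈p∪q⁺ (inj₂ (x∈⁅x⁆ v)) , ¬Pv) ,
     ≤-trans (m≤n+m∸n k 1) (insert-size k-1≤∣e∣ (proj₁ (to ⊆-remove⇔ U⊆W-v) ∘ e⊆U))) ,
    ∪⁅⁆-mono e⊆U

-- Shed any vertex outside P; if there is none, no face exists.
vd-Escaping : ∀ {n} {P : Fin n → Set} → Decidable P →
  ∀ (W : Subset n) k → VertexDecomposable W (Dual (Escaping P k) W)
vd-Escaping {n} {P} P? =
  removal-induction (λ W → ∀ k → VertexDecomposable W (Dual (Escaping P k) W)) step
  where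
  step : ∀ (W : Subset n) → (∀ {v} → v ∈ W → ∀ k → VertexDecomposable (W - v) (Dual (Escaping P k) (W - v))) →
         ∀ k → VertexDecomposable W (Dual (Escaping P k) W)
  step W ih k with outside-or-inside P? W
  ... | inj₂ W⊆P = void-Dual λ e ((x , x∈e , ¬Px) , _) e⊆W → ¬Px (W⊆P (e⊆W x∈e))
  ... | inj₁ (v , v∈W , ¬Pv) =
    shed-Dual v∈W (exchange-Escaping ¬Pv) (deletion-Escaping ¬Pv)
      (vd-AtLeast (W - v) (pred k)) (ih v∈W k)

cd? : ∀ d (C : Family n) → Decidable (cd d C)
cd? d C e = (∣ e ∣ ≟ℕ d) ×-dec (C e ≟ᵇ false)

module CompleteNeighbourhood {d' : ℕ} {C : Family n} {W : Subset n} {v : Fin n}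
  (complete : CompleteNbhdVertex (suc (suc d')) C W v) where

  private
    d : ℕ
    d = suc (suc d')
    N : Fin n → Set
    N = Nbhd C W v
    v∈W : v ∈ W
    v∈W = proj₁ complete

  nbhd? : Decidable N
  nbhd? x = anySubset? λ e → ((C e ≟ᵇ true) ×-dec (e ⊆? W)) ×-dec (x ∈? e) ×-dec (v ∈? e)

  self-neighbour : N x → N v
  self-neighbour (f , circuit , _ , v∈f) = f , circuit , v∈f , v∈f

  cd-escapes : cd d C e → ¬ (∀ {x} → x ∈ e → N x)
  cd-escapes {e = e} (∣e∣≡d , Ce≡false) e⊆N =
    not-¬ Ce≡false (proj₁ (proj₁ (from (proj₂ complete e) (e⊆N , ∣e∣≡d))))

  -- A d-set has a second point next to any given one, since d ≥ 2.
  other-point : ∣ e ∣ ≡ d → ∀ x → Nonempty (e - x)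
  other-point {e = e} ∣e∣≡d x = nonempty-of-size (≤-trans (s≤s z≤n) (pred≤∣p-x∣ e x (≤-reflexive (sym ∣e∣≡d))))

  -- If no exchange keeps e out of C, every point of e is a neighbour of v,
  -- which completeness forbids.
  exchange-cd : Exchange (cd d C) W v
  exchange-cd e (∣e∣≡d , Ce≡false) e⊆W v∉e
    with outside-or-inside (λ w → C ((e - w) ∪ ⁅ v ⁆) ≟ᵇ true) e
  ... | inj₁ (w , w∈e , notCircuit) = w , w∈e , trans (∣swap∣ w∈e v∉e) ∣e∣≡d , ¬-not notCircuit
  ... | inj₂ allCircuits = ⊥-elim (cd-escapes (∣e∣≡d , Ce≡false) e⊆N)
    where
    e⊆N : ∀ {x} → x ∈ e → N x
    e⊆N {x} x∈e =
      let w , w∈e-x = other-point ∣e∣≡d x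
          w∈e , w≢x = x∈p-y⁻ e w∈e-x
      in  (e - w) ∪ ⁅ v ⁆ ,
          (allCircuits w∈e , ∪⁅⁆-⊆ (⊆-trans (p─q⊆p e _) e⊆W) v∈W) ,
          x∈p∪q⁺ (inj₁ (x∈p∧x≢y⇒x∈p-y x∈e (w≢x ∘ sym))) ,
          x∈p∪q⁺ (inj₂ (x∈⁅x⁆ v))

  deletion-cd : DeletionMatch (cd d C) (Escaping N (suc d')) W v
  deletion-cd U U⊆W-v = mk⇔ forward backward
    where
    forward : Hits (cd d C) (U ∪ ⁅ v ⁆) → Hits (Escaping N (suc d')) U
    forward (e , (∣e∣≡d , Ce≡false) , e⊆U∪v) with outside-or-inside nbhd? (e - v)
    ... | inj₁ escape = e - v , (escape , pred≤∣p-x∣ e v (≤-reflexive (sym ∣e∣≡d))) , -⁅⁆-⊆ e⊆U∪v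
    ... | inj₂ e-v⊆N  = ⊥-elim (cd-escapes (∣e∣≡d , Ce≡false) e⊆N)
      where
      e⊆N : ∀ {x} → x ∈ e → N x
      e⊆N {x} x∈e with x ≟ᶠ v
      ... | yes refl = self-neighbour (e-v⊆N (proj₂ (other-point ∣e∣≡d v)))
      ... | no x≢v   = e-v⊆N (x∈p∧x≢y⇒x∈p-y x∈e x≢v)
    backward : Hits (Escaping N (suc d')) U → Hits (cd d C) (U ∪ ⁅ v ⁆)
    backward (e , ((x , x∈e , ¬Nx) , d-1≤∣e∣) , e⊆U) with pick-through x∈e d-1≤∣e∣
    ... | T , T⊆e , x∈T , ∣T∣≡d-1 =
      T ∪ ⁅ v ⁆ , (∣T∪v∣≡d , ¬-not (¬Nx ∘ x-neighbour)) , ∪⁅⁆-mono (⊆-trans T⊆e e⊆U)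
      where
      T⊆W-v : T ⊆ W - v
      T⊆W-v = ⊆-trans T⊆e (⊆-trans e⊆U U⊆W-v)
      ∣T∪v∣≡d : ∣ T ∪ ⁅ v ⁆ ∣ ≡ d
      ∣T∪v∣≡d = trans (∣p∪⁅x⁆∣≡1+∣p∣ T (proj₁ (to ⊆-remove⇔ T⊆W-v))) (cong suc ∣T∣≡d-1)
      x-neighbour : C (T ∪ ⁅ v ⁆) ≡ true → N x
      x-neighbour circuit =
        T ∪ ⁅ v ⁆ , (circuit , ∪⁅⁆-⊆ (proj₂ (to ⊆-remove⇔ T⊆W-v)) v∈W) ,
        x∈p∪q⁺ (inj₁ x∈T) , x∈p∪q⁺ (inj₂ (x∈⁅x⁆ v))

vd-cd≥2 : ∀ {n d'} {C : Family n} →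
  (∀ W → Nonempty W → Σ (Fin n) λ v → CompleteNbhdVertex (suc (suc d')) C W v) →
  ∀ W → VertexDecomposable W (Dual (cd (suc (suc d')) C) W)
vd-cd≥2 {n} {d'} {C} hyp =
  removal-induction (λ W → VertexDecomposable W (Dual (cd (suc (suc d')) C) W)) step
  where
  step : ∀ (W : Subset n) → (∀ {v} → v ∈ W → VertexDecomposable (W - v) (Dual (cd (suc (suc d')) C) (W - v))) →
         VertexDecomposable W (Dual (cd (suc (suc d')) C) W)
  step W ih with nonempty? W
  ... | no empty = void-Dual λ e (∣e∣≡d , _) → positive⊈empty empty (≤-trans (s≤s z≤n) (≤-reflexive (sym ∣e∣≡d)))
  ... | yes nonempty with hyp W nonempty
  ...   | v , complete =
    shed-Dual (proj₁ complete) exchange-cd deletion-cd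
      (vd-Escaping nbhd? (W - v) (suc d')) (ih (proj₁ complete))
    where open CompleteNeighbourhood complete

-- c_0(C) is {∅} or empty, so its duals are full simplices or void.
vd-cd0 : ∀ {n} (C : Family n) W → VertexDecomposable W (Dual (cd 0 C) W)
vd-cd0 {n} C W with C ⊥ ≟ᵇ false
... | yes C⊥≡false = vd-resp (Dual-cong sameHits) (vd-AtLeast W 0)
  where
  sameHits : ∀ U → Hits (AtLeast 0) U ⇔ Hits (cd 0 C) U
  sameHits U = mk⇔ (λ _ → ∅-hits) forget
    where
    ∅-hits : Hits (cd 0 C) U
    ∅-hits = ⊥ , (∣⊥∣≡0 n , C⊥≡false) , ⊥⊆
    forget : Hits (cd 0 C) U → Hits (AtLeast 0) U
    forget (e , _ , e⊆U) = e , z≤n , e⊆U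
... | no C⊥≢false = void-Dual λ e (∣e∣≡0 , Ce≡false) _ →
  C⊥≢false (subst (λ f → C f ≡ false) (∣p∣≡0⇒p≡⊥ ∣e∣≡0) Ce≡false)

-- c_1(C) consists of the singletons {x} ∉ C, which hit exactly the sets
-- containing a point x with {x} ∉ C.
vd-cd1 : ∀ (C : Family n) W → VertexDecomposable W (Dual (cd 1 C) W)
vd-cd1 C W = vd-resp (Dual-cong sameHits) (vd-Escaping (λ x → C ⁅ x ⁆ ≟ᵇ true) W 0)
  where
  sameHits : ∀ U → Hits (Escaping (λ x → C ⁅ x ⁆ ≡ true) 0) U ⇔ Hits (cd 1 C) U
  sameHits U = mk⇔ singleton member
    where
    singleton : Hits (Escaping (λ x → C ⁅ x ⁆ ≡ true) 0) U → Hits (cd 1 C) U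
    singleton (e , ((x , x∈e , ¬C⁅x⁆) , _) , e⊆U) =
      ⁅ x ⁆ , (∣⁅x⁆∣≡1 x , ¬-not ¬C⁅x⁆) ,
      λ y∈⁅x⁆ → subst (_∈ U) (sym (x∈⁅y⁆⇒x≡y x y∈⁅x⁆)) (e⊆U x∈e)
    member : Hits (cd 1 C) U → Hits (Escaping (λ x → C ⁅ x ⁆ ≡ true) 0) U
    member (e , (∣e∣≡1 , Ce≡false) , e⊆U) with nonempty-of-size (≤-reflexive (sym ∣e∣≡1))
    ... | x , x∈e = e , ((x , x∈e , not-¬ C⁅x⁆≡false) , z≤n) , e⊆U
      where
      C⁅x⁆≡false : C ⁅ x ⁆ ≡ false
      C⁅x⁆≡false = subst (λ f → C f ≡ false) (∣p∣≡1⇒p≡⁅x⁆ x∈e ∣e∣≡1) Ce≡false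

vd-cd : ∀ d (C : Family n) →
  (∀ W → Nonempty W → Σ (Fin n) λ v → CompleteNbhdVertex d C W v) →
  ∀ W → VertexDecomposable W (Dual (cd d C) W)
vd-cd zero             C _   = vd-cd0 C
vd-cd (suc zero)       C _   = vd-cd1 C
vd-cd (suc (suc d'))   C hyp = vd-cd≥2 hyp

proposition6p11 : ∀ {n : ℕ} (d : ℕ) (C : Family n) →
    IsClutter C → Uniform d C →
    (∀ (W : Subset n) → Nonempty W → Σ (Fin n) λ v → CompleteNbhdVertex d C W v) →
    VertexDecomposable ⊤ (AlexDual (Ind (cd d C)))
proposition6p11 d C _ _ hyp =
  vd-resp (λ σ → ⇔-sym (alexDual⇔Dual (cd? d C) σ)) (vd-cd d C hyp ⊤)
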